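{- Let $\alpha\in\mathbb{Q}$ with $\alpha\neq 1$, let $a=-\frac{(\alpha-1)\alpha^2(\alpha^2-9)}{(4+\alpha-\alpha^2)^2}$, and let $f(x)=x^2+ax-a$. Then $$f(\alpha)=\left(\frac{\alpha^2-5\alpha}{\alpha^2-\alpha-4}\right)^2,\qquad f(f(\alpha))=\left(\frac{3\alpha^5-13\alpha^4+13\alpha^3-15\alpha^2+12\alpha}{(\alpha^4-2\alpha^3-7\alpha^2+8\alpha+16)(\alpha-1)}\right)^2.$$ In particular, for every $x_0\in\mathbb{Q}$ there exists $a\in\mathbb{Q}$ such that for $f(x)=x^2+ax-a$ both $f(x_0^2)$ and $f(f(x_0^2))$ are squares of rational numbers. -}

module Defs where

open import Data.Rational using (ℚ; 0ℚ; 1ℚ; _+_; _*_; _-_; -_; _÷_; ≢-nonZero)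
open import Data.Rational.Properties using (_≟_)
open import Data.Rational.Literals using (number)
open import Agda.Builtin.FromNat using (Number; fromNat)
open import Relation.Nullary using (yes; no)
open import Data.Unit using (tt)

instance
  ℚ-number : Number ℚ
  ℚ-number = number

-- Total division on ℚ: p /ₜ q = p ÷ q when q ≠ 0, and 0 when q = 0
-- (all denominators in the theorem are in fact nonzero under its hypotheses).
_/ₜ_ : ℚ → ℚ → ℚ
p /ₜ q with q ≟ 0ℚ
... | yes _ = 0ℚ
... | no q≢0 = _÷_ p q {{≢-nonZero q≢0}}
infixl 7 _/ₜ_

sq : ℚ → ℚ
sq x = x * x

f : ℚ → ℚ → ℚ
f a x = x * x + a * x - a

aOf : ℚ → ℚ
aOf α = - (((α - 1ℚ) * (α * α) * (α * α - 9)) /ₜ sq (4 + α - α * α))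

-- Write D = 4 + α − α² and N = (α − 1)α²(α² − 9), so that a = −N/D². Clearing denominators,
-- f(α)·D² = α²D² − N(α − 1) and, with W = D²(α − 1), f(f(α))·W² are polynomials in α (the
-- latter because a·D² and f(α)·D² are), and they are squares M² and P² of polynomials. Hence
-- f(α) = (M/E)² with E = −D and f(f(α)) = (P/W)², as long as D and W do not vanish: α ≠ 1 by
-- hypothesis, and D has no rational root because its discriminant 17 is not a square.
-- Concretely, the homogenisation 4d² + nd − n² has no zero with n and d coprime, because
-- x² − x − 1 has no root modulo 3.

{-# OPTIONS --safe #-}
module Submission where

open import Defs
open import Algebra.Bundles using (CommutativeMonoid)
open import Data.List.Base using ([]; _∷_)
import Data.Integer.Base as ℤ
import Data.Integer.Properties as ℤ
import Data.Nat.Base as ℕ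
open import Data.Nat.Coprimality using (Coprime; recompute)
import Data.Nat.Literals as ℕ
import Data.Nat.Properties as ℕ
open import Data.Product using (_×_; _,_; proj₁; proj₂; ∃)
open import Data.Rational.Literals using (fromℤ)
open import Data.Rational.Properties
  using (_≟_; +-*-commutativeRing; *-1-commutativeMonoid; +-0-group;
         toℚᵘ-injective; toℚᵘ-homo-+; toℚᵘ-homo-*; toℚᵘ-homo‿-;
         *-assoc; *-identityʳ; *-inverseˡ; *-inverseʳ; *-zeroˡ; *-zeroʳ; neg-distribˡ-*)
open import Data.Rational.Unnormalised.Base using (*≡*)
import Data.Rational.Unnormalised.Properties as ℚᵘ
open import Data.Unit using (tt)
open import Function using (_∘_)
open import Level using (0ℓ)
open import Relation.Binary.PropositionalEquality
open import Relation.Nullary using (¬_; yes; no; contradiction)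
open import Relation.Nullary.Decidable using (False; toWitnessFalse; dec⇒maybe)
open import Algebra.Properties.CommutativeSemigroup
  (CommutativeMonoid.commutativeSemigroup *-1-commutativeMonoid) using (interchange)
open import Algebra.Properties.Group +-0-group using (x∙y⁻¹≈ε⇒x≈y)
open import Tactic.RingSolver using (solve-∀)
open import Tactic.RingSolver.Core.AlmostCommutativeRing
  using (AlmostCommutativeRing; fromCommutativeRing)

module Discriminant17 where
  open import Data.Nat.Base using (suc; s≤s)
  open import Data.Integer.Base using (ℤ; +_; _+_; _*_; _-_; ∣_∣)
  open import Data.Integer.Properties using (+-identityˡ)
  open import Data.Integer.DivMod using (_%ℕ_; _/ℕ_; a≡a%ℕn+[a/ℕn]*n; n%ℕd<d)
  open import Data.Integer.Divisibility.Signed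
    using (_∣_; divides; _∣?_; ∣-refl; ∣n⇒∣m*n; ∣m+n∣n⇒∣m; ∣⇒∣ᵤ)
  open import Data.Integer.Tactic.RingSolver using (solve)

  form₁₇ : ℤ → ℤ → ℤ
  form₁₇ n d = + 4 * d * d + n * d - n * n
  -- INLINE lets the ring solver see through this abbreviation (and D, N, … below).
  {-# INLINE form₁₇ #-}

  form₁₇-congruent-mod-3 : ∀ r s q t →
    ∃ λ k → form₁₇ (r + q * + 3) (s + t * + 3) ≡ form₁₇ r s + k * + 3
  form₁₇-congruent-mod-3 r s q t =
    + 8 * s * t + + 12 * t * t + r * t + q * s + + 3 * q * t - + 2 * r * q - + 3 * q * q ,
    solve (r ∷ s ∷ q ∷ t ∷ [])

  ¬3∣ : ∀ x → False (+ 3 ∣? x) → ¬ (+ 3 ∣ x)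
  ¬3∣ x = toWitnessFalse

  3∣form₁₇⇒residues≡0 : ∀ r s → r ℕ.< 3 → s ℕ.< 3 → + 3 ∣ form₁₇ (+ r) (+ s) → r ≡ 0 × s ≡ 0
  3∣form₁₇⇒residues≡0 0 0 _ _ _ = refl , refl
  3∣form₁₇⇒residues≡0 0 1 _ _ h = contradiction h (¬3∣ _ _)
  3∣form₁₇⇒residues≡0 0 2 _ _ h = contradiction h (¬3∣ _ _)
  3∣form₁₇⇒residues≡0 1 0 _ _ h = contradiction h (¬3∣ _ _)
  3∣form₁₇⇒residues≡0 1 1 _ _ h = contradiction h (¬3∣ _ _)
  3∣form₁₇⇒residues≡0 1 2 _ _ h = contradiction h (¬3∣ _ _)
  3∣form₁₇⇒residues≡0 2 0 _ _ h = contradiction h (¬3∣ _ _)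
  3∣form₁₇⇒residues≡0 2 1 _ _ h = contradiction h (¬3∣ _ _)
  3∣form₁₇⇒residues≡0 2 2 _ _ h = contradiction h (¬3∣ _ _)
  3∣form₁₇⇒residues≡0 (suc (suc (suc _))) _ (s≤s (s≤s (s≤s ()))) _ _
  3∣form₁₇⇒residues≡0 _ (suc (suc (suc _))) _ (s≤s (s≤s (s≤s ()))) _

  %ℕ3≡0⇒3∣ : ∀ n → n %ℕ 3 ≡ 0 → + 3 ∣ n
  %ℕ3≡0⇒3∣ n r≡0 = divides (n /ℕ 3) (begin
    n                              ≡⟨ a≡a%ℕn+[a/ℕn]*n n 3 ⟩
    + (n %ℕ 3) + (n /ℕ 3) * + 3    ≡⟨ cong (λ r → + r + (n /ℕ 3) * + 3) r≡0 ⟩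
    + 0 + (n /ℕ 3) * + 3           ≡⟨ +-identityˡ _ ⟩
    (n /ℕ 3) * + 3                 ∎)
    where open ≡-Reasoning

  form₁₇≢0 : ∀ n d → Coprime ∣ n ∣ ∣ d ∣ → form₁₇ n d ≢ + 0
  form₁₇≢0 n d coprime form≡0 =
    contradiction (coprime (∣⇒∣ᵤ (%ℕ3≡0⇒3∣ n r≡0) , ∣⇒∣ᵤ (%ℕ3≡0⇒3∣ d s≡0))) λ ()
    where
    3∣form-of-residues : + 3 ∣ form₁₇ (+ (n %ℕ 3)) (+ (d %ℕ 3))
    3∣form-of-residues with form₁₇-congruent-mod-3 (+ (n %ℕ 3)) (+ (d %ℕ 3)) (n /ℕ 3) (d /ℕ 3)
    ... | k , shift = ∣m+n∣n⇒∣m (divides (+ 0) (begin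
      form₁₇ (+ (n %ℕ 3)) (+ (d %ℕ 3)) + k * + 3
        ≡⟨ shift ⟨
      form₁₇ (+ (n %ℕ 3) + n /ℕ 3 * + 3) (+ (d %ℕ 3) + d /ℕ 3 * + 3)
        ≡⟨ cong₂ form₁₇ (a≡a%ℕn+[a/ℕn]*n n 3) (a≡a%ℕn+[a/ℕn]*n d 3) ⟨
      form₁₇ n d
        ≡⟨ form≡0 ⟩
      + 0 ∎)) (∣n⇒∣m*n k ∣-refl)
      where open ≡-Reasoning

    residues≡0 = 3∣form₁₇⇒residues≡0 (n %ℕ 3) (d %ℕ 3) (n%ℕd<d n 3) (n%ℕd<d d 3) 3∣form-of-residues
    r≡0 = proj₁ residues≡0
    s≡0 = proj₂ residues≡0

open Discriminant17 using (form₁₇; form₁₇≢0)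
open import Agda.Builtin.FromNat using (Number; fromNat)
open import Data.Rational
  using (ℚ; mkℚ; NonZero; 0ℚ; 1ℚ; _+_; _*_; _-_; -_; 1/_; ≢-nonZero; toℚᵘ; ↥_; ↧_)

instance
  ℕ-number : Number ℕ.ℕ
  ℕ-number = ℕ.number

ℚ-ring : AlmostCommutativeRing 0ℓ 0ℓ
ℚ-ring = fromCommutativeRing +-*-commutativeRing (λ x → dec⇒maybe (0ℚ ≟ x))

fromℤ-homo-+ : ∀ a b → fromℤ (a ℤ.+ b) ≡ fromℤ a + fromℤ b
fromℤ-homo-+ a b = toℚᵘ-injective (ℚᵘ.≃-sym (ℚᵘ.≃-trans (toℚᵘ-homo-+ (fromℤ a) (fromℤ b)) (*≡* (begin
  (a ℤ.* ℤ.1ℤ ℤ.+ b ℤ.* ℤ.1ℤ) ℤ.* ℤ.1ℤ  ≡⟨ ℤ.*-identityʳ _ ⟩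
  a ℤ.* ℤ.1ℤ ℤ.+ b ℤ.* ℤ.1ℤ             ≡⟨ cong₂ ℤ._+_ (ℤ.*-identityʳ a) (ℤ.*-identityʳ b) ⟩
  a ℤ.+ b                                 ≡⟨ ℤ.*-identityʳ _ ⟨
  (a ℤ.+ b) ℤ.* ℤ.1ℤ                     ∎))))
  where open ≡-Reasoning

fromℤ-homo-* : ∀ a b → fromℤ (a ℤ.* b) ≡ fromℤ a * fromℤ b
fromℤ-homo-* a b = toℚᵘ-injective (ℚᵘ.≃-sym (toℚᵘ-homo-* (fromℤ a) (fromℤ b)))

fromℤ-homo‿- : ∀ a → fromℤ (ℤ.- a) ≡ - fromℤ a
fromℤ-homo‿- a = toℚᵘ-injective (ℚᵘ.≃-sym (toℚᵘ-homo‿- (fromℤ a)))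

fromℤ-homo-sub : ∀ a b → fromℤ (a ℤ.- b) ≡ fromℤ a - fromℤ b
fromℤ-homo-sub a b = trans (fromℤ-homo-+ a (ℤ.- b)) (cong (fromℤ a +_) (fromℤ-homo‿- b))

fromℤ-injective : ∀ {a b} → fromℤ a ≡ fromℤ b → a ≡ b
fromℤ-injective = cong ↥_

*-denominator≡numerator : ∀ p → p * fromℤ (↧ p) ≡ fromℤ (↥ p)
*-denominator≡numerator p@(mkℚ n d-1 _) = toℚᵘ-injective (ℚᵘ.≃-trans (toℚᵘ-homo-* p (fromℤ (↧ p)))
  (*≡* (trans (ℤ.*-identityʳ _) (cong (λ k → n ℤ.* ℤ.+ ℕ.suc k) (sym (ℕ.*-identityʳ d-1))))))

fromℤ-form₁₇ : ∀ n d →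
  fromℤ (form₁₇ n d) ≡ 4 * fromℤ d * fromℤ d + fromℤ n * fromℤ d - fromℤ n * fromℤ n
fromℤ-form₁₇ n d = begin
  fromℤ (ℤ.+ 4 ℤ.* d ℤ.* d ℤ.+ n ℤ.* d ℤ.- n ℤ.* n)
    ≡⟨ fromℤ-homo-sub (ℤ.+ 4 ℤ.* d ℤ.* d ℤ.+ n ℤ.* d) (n ℤ.* n) ⟩
  fromℤ (ℤ.+ 4 ℤ.* d ℤ.* d ℤ.+ n ℤ.* d) - fromℤ (n ℤ.* n)
    ≡⟨ cong₂ _-_ (fromℤ-homo-+ (ℤ.+ 4 ℤ.* d ℤ.* d) (n ℤ.* d)) (fromℤ-homo-* n n) ⟩
  fromℤ (ℤ.+ 4 ℤ.* d ℤ.* d) + fromℤ (n ℤ.* d) - fromℤ n * fromℤ n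
    ≡⟨ cong₂ (λ u v → u + v - fromℤ n * fromℤ n)
             (trans (fromℤ-homo-* (ℤ.+ 4 ℤ.* d) d) (cong (_* fromℤ d) (fromℤ-homo-* (ℤ.+ 4) d)))
             (fromℤ-homo-* n d) ⟩
  4 * fromℤ d * fromℤ d + fromℤ n * fromℤ d - fromℤ n * fromℤ n ∎
  where open ≡-Reasoning

homogenise-4+x-x² : ∀ x δ →
  4 * δ * δ + (x * δ) * δ - (x * δ) * (x * δ) ≡ δ * δ * (4 + x - x * x)
homogenise-4+x-x² = solve-∀ ℚ-ring

4+x-x²≢0 : ∀ x → 4 + x - x * x ≢ 0ℚ
4+x-x²≢0 x@(mkℚ n _ coprime) 4+x-x²≡0 =
  form₁₇≢0 n d (recompute coprime) (fromℤ-injective (begin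
    fromℤ (form₁₇ n d)
      ≡⟨ fromℤ-form₁₇ n d ⟩
    4 * δ * δ + fromℤ n * δ - fromℤ n * fromℤ n
      ≡⟨ cong (λ y → 4 * δ * δ + y * δ - y * y) (*-denominator≡numerator x) ⟨
    4 * δ * δ + (x * δ) * δ - (x * δ) * (x * δ)
      ≡⟨ homogenise-4+x-x² x δ ⟩
    δ * δ * (4 + x - x * x)
      ≡⟨ cong (δ * δ *_) 4+x-x²≡0 ⟩
    δ * δ * 0ℚ
      ≡⟨ *-zeroʳ (δ * δ) ⟩
    0ℚ ∎))
  where
  open ≡-Reasoning
  d = ↧ x
  δ = fromℤ d

*-cancelʳ-≢0 : ∀ {x y} c → c ≢ 0ℚ → x * c ≡ y * c → x ≡ y
*-cancelʳ-≢0 {x} {y} c c≢0 xc≡yc = begin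
  x            ≡⟨ z*c*1/c≡z x ⟨
  x * c * 1/ c ≡⟨ cong (_* 1/ c) xc≡yc ⟩
  y * c * 1/ c ≡⟨ z*c*1/c≡z y ⟩
  y            ∎
  where
  open ≡-Reasoning
  instance
    c-nonZero : NonZero c
    c-nonZero = ≢-nonZero c≢0
  z*c*1/c≡z : ∀ z → z * c * 1/ c ≡ z
  z*c*1/c≡z z = trans (*-assoc z c (1/ c)) (trans (cong (z *_) (*-inverseʳ c)) (*-identityʳ z))

*-≢0 : ∀ {p q} → p ≢ 0ℚ → q ≢ 0ℚ → p * q ≢ 0ℚ
*-≢0 {p} {q} p≢0 q≢0 pq≡0 = p≢0 (*-cancelʳ-≢0 q q≢0 (trans pq≡0 (sym (*-zeroˡ q))))

p/ₜq*q≡p : ∀ p {q} → q ≢ 0ℚ → p /ₜ q * q ≡ p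
p/ₜq*q≡p p {q} q≢0 with q ≟ 0ℚ
... | yes q≡0 = contradiction q≡0 q≢0
... | no _ = trans (*-assoc p (1/ q) q) (trans (cong (p *_) (*-inverseˡ q)) (*-identityʳ p))
  where
  instance
    q-nonZero : NonZero q
    q-nonZero = ≢-nonZero q≢0

x*q²≡p²⇒x≡sq[p/ₜq] : ∀ {x} p {q} → q ≢ 0ℚ → x * (q * q) ≡ p * p → x ≡ sq (p /ₜ q)
x*q²≡p²⇒x≡sq[p/ₜq] {x} p {q} q≢0 xq²≡p² = *-cancelʳ-≢0 (q * q) (*-≢0 q≢0 q≢0) (begin
  x * (q * q)                          ≡⟨ xq²≡p² ⟩
  p * p                                ≡⟨ cong₂ _*_ (p/ₜq*q≡p p q≢0) (p/ₜq*q≡p p q≢0) ⟨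
  (p /ₜ q * q) * (p /ₜ q * q)          ≡⟨ interchange (p /ₜ q) (p /ₜ q) q q ⟨
  sq (p /ₜ q) * (q * q)                ∎)
  where open ≡-Reasoning

D N M E P W : ℚ → ℚ
D α = 4 + α - α * α
N α = (α - 1ℚ) * (α * α) * (α * α - 9)
M α = α * α - 5 * α
E α = α * α - α - 4
P α = 3 * (α * α * α * α * α) - 13 * (α * α * α * α) + 13 * (α * α * α) - 15 * (α * α) + 12 * α
W α = (α * α * α * α - 2 * (α * α * α) - 7 * (α * α) + 8 * α + 16) * (α - 1ℚ)
{-# INLINE D #-}
{-# INLINE N #-}
{-# INLINE M #-}
{-# INLINE E #-}
{-# INLINE P #-}
{-# INLINE W #-}

D≡-E : ∀ α → D α ≡ - E α
D≡-E = solve-∀ ℚ-ring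

E*E≡D*D : ∀ α → E α * E α ≡ D α * D α
E*E≡D*D = solve-∀ ℚ-ring

W≡D*D*[α-1] : ∀ α → W α ≡ D α * D α * (α - 1ℚ)
W≡D*D*[α-1] = solve-∀ ℚ-ring

M*M-identity : ∀ α → α * α * (D α * D α) + - N α * (α - 1ℚ) ≡ M α * M α
M*M-identity = solve-∀ ℚ-ring

P*P-identity : ∀ α →
  (M α * M α * (M α * M α) + - N α * (M α * M α) - - N α * (D α * D α)) * ((α - 1ℚ) * (α - 1ℚ))
    ≡ P α * P α
P*P-identity = solve-∀ ℚ-ring

f-*-scale : ∀ a x c → (x * x + a * x - a) * c ≡ x * x * c + a * c * (x - 1ℚ)
f-*-scale = solve-∀ ℚ-ring

f-*-square-scale : ∀ a x c g →
  (x * x + a * x - a) * ((c * g) * (c * g))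
    ≡ ((x * c) * (x * c) + (a * c) * (x * c) - (a * c) * c) * (g * g)
f-*-square-scale = solve-∀ ℚ-ring

E≢0 : ∀ α → E α ≢ 0ℚ
E≢0 α E≡0 = 4+x-x²≢0 α (trans (D≡-E α) (cong -_ E≡0))

W≢0 : ∀ α → α ≢ 1ℚ → W α ≢ 0ℚ
W≢0 α α≢1 W≡0 =
  *-≢0 (*-≢0 (4+x-x²≢0 α) (4+x-x²≢0 α)) (α≢1 ∘ x∙y⁻¹≈ε⇒x≈y α 1ℚ)
       (trans (sym (W≡D*D*[α-1] α)) W≡0)

aOf*D*D≡-N : ∀ α → aOf α * (D α * D α) ≡ - N α
aOf*D*D≡-N α = trans (sym (neg-distribˡ-* (N α /ₜ sq (D α)) (D α * D α)))
                     (cong -_ (p/ₜq*q≡p (N α) (*-≢0 (4+x-x²≢0 α) (4+x-x²≢0 α))))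

f[α]*D²≡M² : ∀ α → f (aOf α) α * (D α * D α) ≡ M α * M α
f[α]*D²≡M² α = begin
  f (aOf α) α * (D α * D α)
    ≡⟨ f-*-scale (aOf α) α (D α * D α) ⟩
  α * α * (D α * D α) + aOf α * (D α * D α) * (α - 1ℚ)
    ≡⟨ cong (λ t → α * α * (D α * D α) + t * (α - 1ℚ)) (aOf*D*D≡-N α) ⟩
  α * α * (D α * D α) + - N α * (α - 1ℚ)
    ≡⟨ M*M-identity α ⟩
  M α * M α ∎
  where open ≡-Reasoning

f[f[α]]*W²≡P² : ∀ α → f (aOf α) (f (aOf α) α) * (W α * W α) ≡ P α * P α
f[f[α]]*W²≡P² α = begin
  f A y * (W α * W α)
    ≡⟨ cong (λ w → f A y * (w * w)) (W≡D*D*[α-1] α) ⟩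
  f A y * ((D² * (α - 1ℚ)) * (D² * (α - 1ℚ)))
    ≡⟨ f-*-square-scale A y D² (α - 1ℚ) ⟩
  ((y * D²) * (y * D²) + (A * D²) * (y * D²) - (A * D²) * D²) * ((α - 1ℚ) * (α - 1ℚ))
    ≡⟨ cong₂ (λ u v → (u * u + v * u - v * D²) * ((α - 1ℚ) * (α - 1ℚ)))
             (f[α]*D²≡M² α) (aOf*D*D≡-N α) ⟩
  (M α * M α * (M α * M α) + - N α * (M α * M α) - - N α * D²) * ((α - 1ℚ) * (α - 1ℚ))
    ≡⟨ P*P-identity α ⟩
  P α * P α ∎
  where
  open ≡-Reasoning
  A = aOf α
  y = f A α
  D² = D α * D α

f-aOf-α≡sq : ∀ α → f (aOf α) α ≡ sq (M α /ₜ E α)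
f-aOf-α≡sq α =
  x*q²≡p²⇒x≡sq[p/ₜq] (M α) (E≢0 α) (trans (cong (f (aOf α) α *_) (E*E≡D*D α)) (f[α]*D²≡M² α))

f-f-aOf-α≡sq : ∀ α → α ≢ 1ℚ → f (aOf α) (f (aOf α) α) ≡ sq (P α /ₜ W α)
f-f-aOf-α≡sq α α≢1 = x*q²≡p²⇒x≡sq[p/ₜq] (P α) (W≢0 α α≢1) (f[f[α]]*W²≡P² α)

∃-parameter-with-square-iterates : ∀ α →
  ∃ λ a → (∃ λ r → f a α ≡ r * r) × (∃ λ s → f a (f a α) ≡ s * s)
∃-parameter-with-square-iterates α with α ≟ 1ℚ
... | yes refl = 0ℚ , (1ℚ , refl) , (1ℚ , refl)  -- 1 is a fixed point of every f a
... | no α≢1 = aOf α , (M α /ₜ E α , f-aOf-α≡sq α) , (P α /ₜ W α , f-f-aOf-α≡sq α α≢1)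

mainTheorem5 :
  ((α : ℚ) → α ≢ 1ℚ →
    (f (aOf α) α ≡ sq ((α * α - 5 * α) /ₜ (α * α - α - 4)))
    × (f (aOf α) (f (aOf α) α)
        ≡ sq ((3 * (α * α * α * α * α) - 13 * (α * α * α * α) + 13 * (α * α * α)
                 - 15 * (α * α) + 12 * α)
              /ₜ ((α * α * α * α - 2 * (α * α * α) - 7 * (α * α) + 8 * α + 16) * (α - 1ℚ)))))
  × ((x₀ : ℚ) → ∃ λ (a : ℚ) →
       (∃ λ (r : ℚ) → f a (x₀ * x₀) ≡ r * r)
       × (∃ λ (s : ℚ) → f a (f a (x₀ * x₀)) ≡ s * s))
mainTheorem5 =
  (λ α α≢1 → f-aOf-α≡sq α , f-f-aOf-α≡sq α α≢1) ,
  λ x₀ → ∃-parameter-with-square-iterates (x₀ * x₀)
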